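{- Let $\mathcal{C}$ be a left sum-generating class all of whose members are well-orders. Then $\mathcal{C}$ is principal; in fact $\mathcal{C} = \langle \alpha \rangle$ for some additively indecomposable ordinal $\alpha$.
   Context: A class $\mathcal{C}$ of linear orders is left sum-generating if: (i) it is closed under isomorphism; (ii) $A + B \in \mathcal{C}$ implies $B \in \mathcal{C}$; (iii) if $\beta$ is an ordinal and $A_\alpha \in \mathcal{C}$ for all $\alpha<\beta$, then $\sum_{\alpha<\beta} A_\alpha \in \mathcal{C}$. For a linear order $A$, $\langle A\rangle$ is the smallest left sum-generating class containing $A$; $\mathcal{C}$ is principal if $\mathcal{C}=\langle A\rangle$ for some $A \in \mathcal{C}$. A linear order $A$ is additively indecomposable if whenever $A \cong B + C$, $A$ embeds into $B$ or $A$ embeds into $C$. -}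

module Defs where

open import Level using (Level; _⊔_) renaming (suc to lsuc)
open import Data.Sum using (_⊎_; inj₁; inj₂)
open import Data.Product using (Σ; _×_; _,_; proj₁; proj₂)
open import Data.Empty using (⊥)
open import Relation.Nullary using (¬_)
open import Relation.Binary.PropositionalEquality using (_≡_; refl)
open import Induction.WellFounded using (WellFounded)
open import Function.Bundles using (_⇔_)

record LinOrd (ℓ : Level) : Set (lsuc ℓ) where
  field
    Carrier : Set ℓ
    _<_     : Carrier → Carrier → Set ℓ
    irrefl  : ∀ x → ¬ (x < x)
    trans   : ∀ {x y z} → x < y → y < z → x < z
    connex  : ∀ x y → x < y ⊎ (x ≡ y ⊎ y < x)

open LinOrd public

private variable ℓ c : Level

IsWellOrder : LinOrd ℓ → Set ℓ
IsWellOrder A = WellFounded (_<_ A)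

record _≅_ (A B : LinOrd ℓ) : Set ℓ where
  field
    to      : Carrier A → Carrier B
    from    : Carrier B → Carrier A
    from∘to : ∀ x → from (to x) ≡ x
    to∘from : ∀ y → to (from y) ≡ y
    mono    : ∀ {x y} → _<_ A x y → _<_ B (to x) (to y)

-- Embedding of linear orders: strictly increasing map
-- (for linear orders this is automatically injective and order-reflecting).
record _↪_ (A B : LinOrd ℓ) : Set ℓ where
  field
    map  : Carrier A → Carrier B
    mono : ∀ {x y} → _<_ A x y → _<_ B (map x) (map y)

module _ (A B : LinOrd ℓ) where
  data _<+_ : Carrier A ⊎ Carrier B → Carrier A ⊎ Carrier B → Set ℓ where
    l<l : ∀ {x y} → _<_ A x y → inj₁ x <+ inj₁ y
    r<r : ∀ {x y} → _<_ B x y → inj₂ x <+ inj₂ y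
    l<r : ∀ {x y} → inj₁ x <+ inj₂ y

  private
    +irr : ∀ x → ¬ (x <+ x)
    +irr (inj₁ x) (l<l p) = irrefl A x p
    +irr (inj₂ x) (r<r p) = irrefl B x p

    +trans : ∀ {x y z} → x <+ y → y <+ z → x <+ z
    +trans (l<l p) (l<l q) = l<l (trans A p q)
    +trans (l<l p) l<r = l<r
    +trans (r<r p) (r<r q) = r<r (trans B p q)
    +trans l<r (r<r q) = l<r

    +con : ∀ x y → x <+ y ⊎ (x ≡ y ⊎ y <+ x)
    +con (inj₁ x) (inj₁ y) with connex A x y
    ... | inj₁ p = inj₁ (l<l p)
    ... | inj₂ (inj₁ refl) = inj₂ (inj₁ refl)
    ... | inj₂ (inj₂ p) = inj₂ (inj₂ (l<l p))
    +con (inj₁ x) (inj₂ y) = inj₁ l<r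
    +con (inj₂ x) (inj₁ y) = inj₂ (inj₂ l<r)
    +con (inj₂ x) (inj₂ y) with connex B x y
    ... | inj₁ p = inj₁ (r<r p)
    ... | inj₂ (inj₁ refl) = inj₂ (inj₁ refl)
    ... | inj₂ (inj₂ p) = inj₂ (inj₂ (r<r p))

  _⊕_ : LinOrd ℓ
  _⊕_ = record
    { Carrier = Carrier A ⊎ Carrier B ; _<_ = _<+_
    ; irrefl = +irr ; trans = +trans ; connex = +con }

module _ (β : LinOrd ℓ) (A : Carrier β → LinOrd ℓ) where
  SCar : Set ℓ
  SCar = Σ (Carrier β) (λ b → Carrier (A b))

  data _<Σ_ : SCar → SCar → Set ℓ where
    fst< : ∀ {b b' x x'} → _<_ β b b' → (b , x) <Σ (b' , x')
    snd< : ∀ {b x x'} → _<_ (A b) x x' → (b , x) <Σ (b , x')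

  private
    Σirr : ∀ x → ¬ (x <Σ x)
    Σirr (b , x) (fst< p) = irrefl β b p
    Σirr (b , x) (snd< p) = irrefl (A b) x p

    Σtrans : ∀ {x y z} → x <Σ y → y <Σ z → x <Σ z
    Σtrans (fst< p) (fst< q) = fst< (trans β p q)
    Σtrans (fst< p) (snd< q) = fst< p
    Σtrans (snd< p) (fst< q) = fst< q
    Σtrans {b , _} (snd< p) (snd< q) = snd< (trans (A b) p q)

    Σcon : ∀ x y → x <Σ y ⊎ (x ≡ y ⊎ y <Σ x)
    Σcon (b , x) (b' , x') with connex β b b'
    ... | inj₁ p = inj₁ (fst< p)
    ... | inj₂ (inj₂ p) = inj₂ (inj₂ (fst< p))
    ... | inj₂ (inj₁ refl) with connex (A b) x x'
    ...   | inj₁ p = inj₁ (snd< p)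
    ...   | inj₂ (inj₁ refl) = inj₂ (inj₁ refl)
    ...   | inj₂ (inj₂ p) = inj₂ (inj₂ (snd< p))

  ∑ : LinOrd ℓ
  ∑ = record
    { Carrier = SCar ; _<_ = _<Σ_
    ; irrefl = Σirr ; trans = Σtrans ; connex = Σcon }

Class : (ℓ c : Level) → Set (lsuc ℓ ⊔ lsuc c)
Class ℓ c = LinOrd ℓ → Set c

record LeftSumGenerating {ℓ c} (C : Class ℓ c) : Set (lsuc ℓ ⊔ c) where
  field
    iso-closed : ∀ {A B} → A ≅ B → C A → C B
    right-summand : ∀ A B → C (A ⊕ B) → C B
    ord-sums : ∀ (β : LinOrd ℓ) → IsWellOrder β →
               (A : Carrier β → LinOrd ℓ) → (∀ b → C (A b)) → C (∑ β A)

-- ⟨ A ⟩ : the smallest left sum-generating class containing A,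
-- given as the inductively generated class.
data ⟨_⟩ {ℓ} (A : LinOrd ℓ) : LinOrd ℓ → Set (lsuc ℓ) where
  base    : ⟨ A ⟩ A
  iso     : ∀ {B D} → B ≅ D → ⟨ A ⟩ B → ⟨ A ⟩ D
  rsum    : ∀ B D → ⟨ A ⟩ (B ⊕ D) → ⟨ A ⟩ D
  ordsum  : ∀ (β : LinOrd ℓ) → IsWellOrder β →
            (F : Carrier β → LinOrd ℓ) → (∀ b → ⟨ A ⟩ (F b)) → ⟨ A ⟩ (∑ β F)

AdditivelyIndecomposable : LinOrd ℓ → Set (lsuc ℓ)
AdditivelyIndecomposable A =
  ∀ (B D : LinOrd _) → A ≅ (B ⊕ D) → (A ↪ B) ⊎ (A ↪ D)

{-# OPTIONS --safe #-}
module Submission where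

-- Take for α a nonempty member of C embedding into every nonempty member (or
-- the empty order if C has none). It exists because any two well-orders are
-- comparable: one is isomorphic to the other or to a proper initial segment of
-- it. Every B ∈ C is a sum of copies of α: comparing B with B·α (B copies of α)
-- leaves only the case B ≅ (B↾b)·α + (α↾a), and the remainder α↾a lies in C,
-- so it is empty by leastness. Likewise α is additively indecomposable, since
-- a nonempty right summand of α lies in C.

open import Defs
open import Level using (Level; _⊔_) renaming (suc to lsuc)
open import Data.Product using (Σ; _×_; _,_; proj₁; proj₂)
open import Data.Sum using (_⊎_; inj₁; inj₂)
open import Data.Empty using (⊥-elim; ⊥-elim-irr)
import Data.Empty.Polymorphic as Polymorphic
open import Relation.Nullary using (¬_; yes; no)
open import Relation.Nullary.Decidable using (recompute; decidable-stable)
open import Relation.Binary.PropositionalEquality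
  using (_≡_; refl; sym; subst; subst₂)
import Relation.Binary.PropositionalEquality as ≡
open import Function.Base using (case_of_)
open import Function.Bundles using (_⇔_; mk⇔)
open import Induction.WellFounded using (Acc; acc)
open import Axiom.ExcludedMiddle using (ExcludedMiddle)
import Relation.Binary.Construct.On as On

open _≅_
open _↪_

private variable ℓ ℓ′ : Level

-- Membership is irrelevant, so that elements of a sub-order are equal as soon
-- as their underlying elements are, although x < a need not be a proposition.
record SubCarrier (A : LinOrd ℓ) (P : Carrier A → Set ℓ) : Set ℓ where
  constructor mk
  field
    elt : Carrier A
    .prf : P elt
open SubCarrier

Sub : (A : LinOrd ℓ) → (Carrier A → Set ℓ) → LinOrd ℓ
Sub A P = record
  { Carrier = SubCarrier A P
  ; _<_ = λ u v → _<_ A (elt u) (elt v)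
  ; irrefl = λ u → irrefl A (elt u)
  ; trans = trans A
  ; connex = connex-Sub }
  where
  connex-Sub : ∀ u v → _<_ A (elt u) (elt v) ⊎ (u ≡ v ⊎ _<_ A (elt v) (elt u))
  connex-Sub (mk x p) (mk y q) with connex A x y
  ... | inj₁ x<y = inj₁ x<y
  ... | inj₂ (inj₁ refl) = inj₂ (inj₁ refl)
  ... | inj₂ (inj₂ y<x) = inj₂ (inj₂ y<x)

Seg : (A : LinOrd ℓ) → Carrier A → LinOrd ℓ
Seg A a = Sub A (λ x → _<_ A x a)

module _ {A : LinOrd ℓ} where

  Sub-≡ : {P : Carrier A → Set ℓ} {u v : SubCarrier A P} → elt u ≡ elt v → u ≡ v
  Sub-≡ {u = mk x p} {mk .x q} refl = refl

  <-recompute : ∀ {x a} → .(_<_ A x a) → _<_ A x a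
  <-recompute {x} {a} x<a with connex A x a
  ... | inj₁ x<a′ = x<a′
  ... | inj₂ (inj₁ refl) = ⊥-elim-irr (irrefl A x x<a)
  ... | inj₂ (inj₂ a<x) = ⊥-elim-irr (irrefl A a (trans A a<x x<a))

  Seg-bound : ∀ {a} (u : Carrier (Seg A a)) → _<_ A (elt u) a
  Seg-bound (mk x x<a) = <-recompute x<a

  Sub-wellFounded : {P : Carrier A → Set ℓ} → IsWellOrder A → IsWellOrder (Sub A P)
  Sub-wellFounded = On.wellFounded elt

module _ {A B : LinOrd ℓ} where

  ≅⇒↪ : A ≅ B → A ↪ B
  ≅⇒↪ f = record { map = to f ; mono = mono f }

  ↪-reflects : (e : A ↪ B) → ∀ {x y} → _<_ B (map e x) (map e y) → _<_ A x y
  ↪-reflects e {x} {y} ex<ey with connex A x y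
  ... | inj₁ x<y = x<y
  ... | inj₂ (inj₁ refl) = ⊥-elim (irrefl B (map e x) ex<ey)
  ... | inj₂ (inj₂ y<x) = ⊥-elim (irrefl B (map e x) (trans B ex<ey (mono e y<x)))

  ≅-sym : A ≅ B → B ≅ A
  ≅-sym f = record
    { to = from f ; from = to f ; from∘to = to∘from f ; to∘from = from∘to f
    ; mono = λ {y} {y′} y<y′ → ↪-reflects (≅⇒↪ f)
        (subst₂ (_<_ B) (sym (to∘from f y)) (sym (to∘from f y′)) y<y′) }

  ≅-empty : ¬ Carrier A → ¬ Carrier B → A ≅ B
  ≅-empty ¬a ¬b = record
    { to = λ x → ⊥-elim (¬a x) ; from = λ y → ⊥-elim (¬b y)
    ; from∘to = λ x → ⊥-elim (¬a x) ; to∘from = λ y → ⊥-elim (¬b y)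
    ; mono = λ {x} _ → ⊥-elim (¬a x) }

  empty↪ : ¬ Carrier A → A ↪ B
  empty↪ ¬a = record { map = λ x → ⊥-elim (¬a x) ; mono = λ {x} _ → ⊥-elim (¬a x) }

≅-trans : {A B D : LinOrd ℓ} → A ≅ B → B ≅ D → A ≅ D
≅-trans f g = record
  { to = λ x → to g (to f x) ; from = λ z → from f (from g z)
  ; from∘to = λ x → ≡.trans (≡.cong (from f) (from∘to g (to f x))) (from∘to f x)
  ; to∘from = λ z → ≡.trans (≡.cong (to g) (to∘from f (from g z))) (to∘from g z)
  ; mono = λ x<y → mono g (mono f x<y) }

↪-trans : {A B D : LinOrd ℓ} → A ↪ B → B ↪ D → A ↪ D
↪-trans e e′ = record { map = λ x → map e′ (map e x) ; mono = λ x<y → mono e′ (mono e x<y) }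

module _ {A : LinOrd ℓ} where

  Sub↪ : {P : Carrier A → Set ℓ} → Sub A P ↪ A
  Sub↪ = record { map = elt ; mono = λ u<v → u<v }

  Sub-cong : {P Q : Carrier A → Set ℓ} →
    (∀ x → P x → Q x) → (∀ x → Q x → P x) → Sub A P ≅ Sub A Q
  Sub-cong P⇒Q Q⇒P = record
    { to = λ { (mk x p) → mk x (P⇒Q x p) }
    ; from = λ { (mk x q) → mk x (Q⇒P x q) }
    ; from∘to = λ _ → refl ; to∘from = λ _ → refl ; mono = λ u<v → u<v }

  Sub-full : {P : Carrier A → Set ℓ} → (∀ x → P x) → Sub A P ≅ A
  Sub-full all = record
    { to = elt ; from = λ x → mk x (all x)
    ; from∘to = λ _ → refl ; to∘from = λ _ → refl ; mono = λ u<v → u<v }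

  Seg-nested : ∀ {a} (y : Carrier (Seg A a)) → Seg (Seg A a) y ≅ Seg A (elt y)
  Seg-nested {a} y = record
    { to = λ u → mk (elt (elt u)) (Seg-bound {A = Seg A a} {y} u)
    ; from = λ v → mk (mk (elt v) (trans A (Seg-bound v) (Seg-bound y))) (Seg-bound v)
    ; from∘to = λ _ → refl ; to∘from = λ _ → refl ; mono = λ u<v → u<v }

Seg-cong : {A B : LinOrd ℓ} (f : A ≅ B) (x : Carrier A) → Seg A x ≅ Seg B (to f x)
Seg-cong {A = A} {B} f x = record
  { to = λ u → mk (to f (elt u)) (mono f (Seg-bound u))
  ; from = λ v → mk (from f (elt v))
      (subst (_<_ A (from f (elt v))) (from∘to f x) (mono (≅-sym f) (Seg-bound v)))
  ; from∘to = λ u → Sub-≡ (from∘to f (elt u))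
  ; to∘from = λ v → Sub-≡ (to∘from f (elt v))
  ; mono = mono f }

⊕-identityʳ : {A E : LinOrd ℓ} → ¬ Carrier E → (A ⊕ E) ≅ A
⊕-identityʳ {A = A} {E} ¬e = record
  { to = left ; from = inj₁ ; from∘to = inj₁∘left ; to∘from = λ _ → refl ; mono = mono-left }
  where
  left : Carrier A ⊎ Carrier E → Carrier A
  left (inj₁ x) = x
  left (inj₂ e) = ⊥-elim (¬e e)
  inj₁∘left : ∀ u → inj₁ (left u) ≡ u
  inj₁∘left (inj₁ x) = refl
  inj₁∘left (inj₂ e) = ⊥-elim (¬e e)
  mono-left : ∀ {u v} → _<+_ A E u v → _<_ A (left u) (left v)
  mono-left (l<l x<y) = x<y
  mono-left (r<r {x} _) = ⊥-elim (¬e x)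
  mono-left (l<r {y = e}) = ⊥-elim (¬e e)

module _ (B : LinOrd ℓ) (F : Carrier B → LinOrd ℓ) (b : Carrier B) (a : Carrier (F b)) where
  private
    Front : LinOrd ℓ
    Front = ∑ (Seg B b) (λ u → F (elt u))
    Split : LinOrd ℓ
    Split = Front ⊕ Seg (F b) a
    _<∑_ : SCar B F → SCar B F → Set ℓ
    _<∑_ = _<Σ_ B F

    split : ∀ {b′ x} → (b′ , x) <∑ (b , a) → Carrier Split
    split {b′} {x} (fst< b′<b) = inj₁ (mk b′ b′<b , x)
    split {x = x} (snd< x<a) = inj₂ (mk x x<a)

    unsplit : Carrier Split → Carrier (Seg (∑ B F) (b , a))
    unsplit (inj₁ (mk b′ b′<b , x)) = mk (b′ , x) (fst< b′<b)
    unsplit (inj₂ (mk x x<a)) = mk (b , x) (snd< x<a)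

    split-fst : ∀ {b′ x} (r : (b′ , x) <∑ (b , a)) (b′<b : _<_ B b′ b) →
      split r ≡ inj₁ (mk b′ b′<b , x)
    split-fst (fst< _) _ = refl
    split-fst (snd< _) b<b = ⊥-elim (irrefl B b b<b)

    split-snd : ∀ {x} (r : (b , x) <∑ (b , a)) (x<a : _<_ (F b) x a) → split r ≡ inj₂ (mk x x<a)
    split-snd (fst< b<b) _ = ⊥-elim (irrefl B b b<b)
    split-snd (snd< _) _ = refl

    split-mono : ∀ {b₁ x₁ b₂ x₂} (r₁ : (b₁ , x₁) <∑ (b , a)) (r₂ : (b₂ , x₂) <∑ (b , a)) →
      (b₁ , x₁) <∑ (b₂ , x₂) → _<+_ Front (Seg (F b) a) (split r₁) (split r₂)
    split-mono (fst< _) (fst< _) (fst< b₁<b₂) = l<l (fst< b₁<b₂)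
    split-mono (fst< _) (fst< _) (snd< x₁<x₂) = l<l (snd< x₁<x₂)
    split-mono (fst< _) (snd< _) _ = l<r
    split-mono (snd< _) (fst< b₂<b) (fst< b<b₂) = ⊥-elim (irrefl B b (trans B b<b₂ b₂<b))
    split-mono (snd< _) (fst< b<b) (snd< _) = ⊥-elim (irrefl B b b<b)
    split-mono (snd< _) (snd< _) (fst< b<b) = ⊥-elim (irrefl B b b<b)
    split-mono (snd< _) (snd< _) (snd< x₁<x₂) = r<r x₁<x₂

  Seg-∑ : Seg (∑ B F) (b , a) ≅ (∑ (Seg B b) (λ u → F (elt u)) ⊕ Seg (F b) a)
  Seg-∑ = record
    { to = λ u → split (Seg-bound u)
    ; from = unsplit
    ; from∘to = λ u → Sub-≡ (unsplit∘split (Seg-bound u))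
    ; to∘from = split∘unsplit
    ; mono = λ {u} {v} → split-mono (Seg-bound u) (Seg-bound v) }
    where
    unsplit∘split : ∀ {b′ x} (r : (b′ , x) <∑ (b , a)) → elt (unsplit (split r)) ≡ (b′ , x)
    unsplit∘split (fst< _) = refl
    unsplit∘split (snd< _) = refl
    split∘unsplit : ∀ v → split (Seg-bound (unsplit v)) ≡ v
    split∘unsplit (inj₁ (mk b′ b′<b , x)) = split-fst _ (<-recompute {A = B} b′<b)
    split∘unsplit (inj₂ (mk x x<a)) = split-snd _ (<-recompute {A = F b} x<a)

module _ {A : LinOrd ℓ} (wf : IsWellOrder A) where

  ↪-inflationary : (e : A ↪ A) → ∀ x → ¬ (_<_ A (map e x) x)
  ↪-inflationary e x = go x (wf x)
    where
    go : ∀ x → Acc (_<_ A) x → ¬ (_<_ A (map e x) x)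
    go x (acc rs) ex<x = go (map e x) (rs ex<x) (mono e ex<x)

  ¬↪Seg : ∀ {a} → ¬ (A ↪ Seg A a)
  ¬↪Seg {a} e = ↪-inflationary (↪-trans e Sub↪) a (Seg-bound (map e a))

¬Seg≅Seg< : {A : LinOrd ℓ} → IsWellOrder A → ∀ {a a′} → _<_ A a a′ → ¬ (Seg A a′ ≅ Seg A a)
¬Seg≅Seg< {A = A} wf {a} {a′} a<a′ h = ¬↪Seg {A = Seg A a′} (Sub-wellFounded wf) {mk a a<a′}
  (≅⇒↪ (≅-trans h (≅-sym (Seg-nested {A = A} (mk a a<a′)))))

Seg-injective : {A : LinOrd ℓ} → IsWellOrder A → ∀ {a a′} → Seg A a ≅ Seg A a′ → a ≡ a′
Seg-injective {A = A} wf {a} {a′} h with connex A a a′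
... | inj₁ a<a′ = ⊥-elim (¬Seg≅Seg< wf a<a′ (≅-sym h))
... | inj₂ (inj₁ a≡a′) = a≡a′
... | inj₂ (inj₂ a′<a) = ⊥-elim (¬Seg≅Seg< wf a′<a h)

Matched : (A B : LinOrd ℓ) → Carrier A → Set ℓ
Matched A B a = Σ (Carrier B) λ b → Seg A a ≅ Seg B b

Matched-downClosed : {A B : LinOrd ℓ} → ∀ {x y} → Matched A B x → _<_ A y x → Matched A B y
Matched-downClosed {A = A} {B} {x} {y} (b , f) y<x = elt (to f y′) ,
  ≅-trans (≅-sym (Seg-nested {A = A} y′)) (≅-trans (Seg-cong f y′) (Seg-nested {A = B} (to f y′)))
  where
  y′ : Carrier (Seg A x)
  y′ = mk y y<x

module Classical (lem : ∀ {p} → ExcludedMiddle p) where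

  minimal-element : {A : LinOrd ℓ} → IsWellOrder A → (P : Carrier A → Set ℓ′) →
    (∀ x → ¬ P x) ⊎ Σ (Carrier A) λ m → P m × (∀ y → _<_ A y m → ¬ P y)
  minimal-element {A = A} wf P with lem {P = Σ (Carrier A) P}
  ... | no none = inj₁ λ x px → none (x , px)
  ... | yes (x , px) = inj₂ (descend x (wf x) px)
    where
    descend : ∀ x → Acc (_<_ A) x → P x → Σ (Carrier A) λ m → P m × (∀ y → _<_ A y m → ¬ P y)
    descend x (acc rs) px with lem {P = Σ (Carrier A) λ y → _<_ A y x × P y}
    ... | yes (y , y<x , py) = descend y (rs y<x) py
    ... | no none = x , px , λ y y<x py → none (y , y<x , py)

  Sub≅⊎Seg : {A : LinOrd ℓ} {P : Carrier A → Set ℓ} → IsWellOrder A →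
    (∀ {x y} → P x → _<_ A y x → P y) →
    (Sub A P ≅ A) ⊎ Σ (Carrier A) λ a → ¬ P a × (Sub A P ≅ Seg A a)
  Sub≅⊎Seg {A = A} {P} wf downClosed with minimal-element {A = A} wf (λ x → ¬ P x)
  ... | inj₁ none = inj₁ (Sub-full λ x → decidable-stable lem (none x))
  ... | inj₂ (a , ¬pa , below) =
    inj₂ (a , ¬pa , Sub-cong P⇒<a λ x x<a → decidable-stable lem (below x x<a))
    where
    P⇒<a : ∀ x → P x → _<_ A x a
    P⇒<a x px with connex A x a
    ... | inj₁ x<a = x<a
    ... | inj₂ (inj₁ refl) = ⊥-elim (¬pa px)
    ... | inj₂ (inj₂ a<x) = ⊥-elim (¬pa (downClosed px a<x))

  matching : {A B : LinOrd ℓ} {a : Carrier A} → .(Matched A B a) → Matched A B a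
  matching {A = A} {B} {a} = recompute (lem {P = Matched A B a})

  match : {A B : LinOrd ℓ} → SubCarrier A (Matched A B) → SubCarrier B (Matched B A)
  match (mk a m) = mk (proj₁ (matching m)) (a , ≅-sym (proj₂ (matching m)))

  match-involutive : {A B : LinOrd ℓ} → IsWellOrder A →
    (u : SubCarrier A (Matched A B)) → match (match u) ≡ u
  match-involutive {A = A} {B} wf (mk a m) =
    Sub-≡ (Seg-injective wf (≅-trans (≅-sym f′) (≅-sym f)))
    where
    f : Seg A a ≅ Seg B (elt (match (mk a m)))
    f = proj₂ (matching m)
    f′ : Seg B (elt (match (mk a m))) ≅ Seg A (elt (match (match (mk a m))))
    f′ = proj₂ (matching (a , ≅-sym f))

  match-mono : {A B : LinOrd ℓ} → IsWellOrder B → {u v : SubCarrier A (Matched A B)} →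
    _<_ A (elt u) (elt v) → _<_ B (elt (match u)) (elt (match v))
  match-mono {A = A} {B} wf {mk a m} {mk a′ m′} a<a′ =
    subst (λ b → _<_ B b (elt (match (mk a′ m′)))) (sym b≡b″) (Seg-bound {A = B} a′↦)
    where
    f : Seg A a ≅ Seg B (elt (match (mk a m)))
    f = proj₂ (matching m)
    f′ : Seg A a′ ≅ Seg B (elt (match (mk a′ m′)))
    f′ = proj₂ (matching m′)
    a′↦ : Carrier (Seg B (elt (match (mk a′ m′))))
    a′↦ = to f′ (mk a a<a′)
    b≡b″ : elt (match (mk a m)) ≡ elt a′↦
    b≡b″ = Seg-injective wf (≅-trans (≅-sym f) (proj₂ (Matched-downClosed (_ , f′) a<a′)))

  Matched-iso : {A B : LinOrd ℓ} → IsWellOrder A → IsWellOrder B →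
    Sub A (Matched A B) ≅ Sub B (Matched B A)
  Matched-iso {A = A} {B} wfA wfB = record
    { to = match ; from = match
    ; from∘to = match-involutive {B = B} wfA ; to∘from = match-involutive {B = A} wfB
    ; mono = λ {u} {v} → match-mono wfB {u} {v} }

  -- The partial isomorphism a ↦ b, Seg A a ≅ Seg B b, has initial segments of A
  -- and B as domain and range; both cannot be proper, as their bounds would match.
  module _ {A B : LinOrd ℓ} (wfA : IsWellOrder A) (wfB : IsWellOrder B) where
    private
      bridge : ∀ {X Y} → Sub A (Matched A B) ≅ X → Sub B (Matched B A) ≅ Y → X ≅ Y
      bridge f g = ≅-trans (≅-sym f) (≅-trans (Matched-iso wfA wfB) g)

    trichotomy : (A ≅ B) ⊎ (Σ (Carrier B) λ b → A ≅ Seg B b) ⊎ (Σ (Carrier A) λ a → Seg A a ≅ B)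
    trichotomy with Sub≅⊎Seg wfA Matched-downClosed | Sub≅⊎Seg wfB Matched-downClosed
    ... | inj₁ f | inj₁ g = inj₁ (bridge f g)
    ... | inj₁ f | inj₂ (b , _ , g) = inj₂ (inj₁ (b , bridge f g))
    ... | inj₂ (a , _ , f) | inj₁ g = inj₂ (inj₂ (a , bridge f g))
    ... | inj₂ (a , a∉ , f) | inj₂ (b , _ , g) = ⊥-elim (a∉ (b , bridge f g))

    ↪⊎Seg≅ : (A ↪ B) ⊎ Σ (Carrier A) λ a → Seg A a ≅ B
    ↪⊎Seg≅ with trichotomy
    ... | inj₁ f = inj₁ (≅⇒↪ f)
    ... | inj₂ (inj₁ (_ , f)) = inj₁ (↪-trans (≅⇒↪ f) Sub↪)
    ... | inj₂ (inj₂ s) = inj₂ s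

𝟘 : LinOrd ℓ
𝟘 = record
  { Carrier = Polymorphic.⊥ ; _<_ = λ _ _ → Polymorphic.⊥
  ; irrefl = λ () ; trans = λ () ; connex = λ () }

⟨⟩⊆ : ∀ {c} {C : Class ℓ c} → LeftSumGenerating C → ∀ {α B} → C α → ⟨ α ⟩ B → C B
⟨⟩⊆ L Cα base = Cα
⟨⟩⊆ L Cα (iso f g) = LeftSumGenerating.iso-closed L f (⟨⟩⊆ L Cα g)
⟨⟩⊆ L Cα (rsum B D g) = LeftSumGenerating.right-summand L B D (⟨⟩⊆ L Cα g)
⟨⟩⊆ L Cα (ordsum β wf F g) = LeftSumGenerating.ord-sums L β wf F λ b → ⟨⟩⊆ L Cα (g b)

module _ {c} (C : Class ℓ c) where

  NonemptyMember : LinOrd ℓ → Set (ℓ ⊔ c)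
  NonemptyMember D = C D × Carrier D

  IsLeastNonempty : LinOrd ℓ → Set (lsuc ℓ ⊔ c)
  IsLeastNonempty α = ∀ D → NonemptyMember D → α ↪ D

  Generator : LinOrd ℓ → Set (lsuc ℓ ⊔ c)
  Generator α = IsWellOrder α × AdditivelyIndecomposable α × C α × (∀ B → C B ⇔ ⟨ α ⟩ B)

module WellOrderClass (lem : ∀ {p} → ExcludedMiddle p) {c} {C : Class ℓ c}
  (L : LeftSumGenerating C) (wo : ∀ A → C A → IsWellOrder A) where
  open LeftSumGenerating L
  open Classical lem

  NonemptyMember-≅ : {A D : LinOrd ℓ} → A ≅ D → NonemptyMember C A → NonemptyMember C D
  NonemptyMember-≅ f (CA , x) = iso-closed f CA , to f x

  minimal⇒least : {α : LinOrd ℓ} → C α → (∀ a → ¬ NonemptyMember C (Seg α a)) →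
    IsLeastNonempty C α
  minimal⇒least Cα minimal D (CD , d) with ↪⊎Seg≅ (wo _ Cα) (wo D CD)
  ... | inj₁ e = e
  ... | inj₂ (a , f) = ⊥-elim (minimal a (NonemptyMember-≅ (≅-sym f) (CD , d)))

  leastNonempty : {γ : LinOrd ℓ} → NonemptyMember C γ →
    Σ (LinOrd ℓ) λ α → NonemptyMember C α × IsLeastNonempty C α
  leastNonempty {γ} (Cγ , g)
    with minimal-element {A = γ} (wo γ Cγ) (λ x → NonemptyMember C (Seg γ x))
  ... | inj₁ none = γ , (Cγ , g) , minimal⇒least Cγ none
  ... | inj₂ (x , (Cx , y) , below) = Seg γ x , (Cx , y) , minimal⇒least Cx λ u m →
    below (elt u) (Seg-bound u) (NonemptyMember-≅ (Seg-nested u) m)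

  least⇒indecomposable : {α : LinOrd ℓ} → C α → IsLeastNonempty C α →
    AdditivelyIndecomposable α
  least⇒indecomposable Cα isLeast B D f with lem {P = Carrier D}
  ... | yes d = inj₂ (isLeast D (right-summand B D (iso-closed f Cα) , d))
  ... | no ¬d = inj₁ (≅⇒↪ (≅-trans f (⊕-identityʳ ¬d)))

  least⇒generates : {α : LinOrd ℓ} → NonemptyMember C α → IsLeastNonempty C α →
    ∀ {B} → C B → ⟨ α ⟩ B
  least⇒generates {α} (Cα , a₀) isLeast {B} CB
    with trichotomy (wo B CB) (wo _ (ord-sums B (wo B CB) (λ _ → α) (λ _ → Cα)))
  ... | inj₁ f = iso (≅-sym f) (ordsum B (wo B CB) (λ _ → α) (λ _ → base))
  ... | inj₂ (inj₂ (b , f)) = ⊥-elim (¬↪Seg (wo B CB) (↪-trans diagonal (≅⇒↪ (≅-sym f))))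
    where
    diagonal : B ↪ ∑ B (λ _ → α)
    diagonal = record { map = λ x → x , a₀ ; mono = fst< }
  ... | inj₂ (inj₁ ((b , a) , f)) =
    iso (≅-sym (≅-trans B≅ (⊕-identityʳ remainder-empty)))
        (ordsum (Seg B b) (Sub-wellFounded (wo B CB)) (λ _ → α) (λ _ → base))
    where
    B≅ : B ≅ (∑ (Seg B b) (λ _ → α) ⊕ Seg α a)
    B≅ = ≅-trans f (Seg-∑ B (λ _ → α) b a)
    remainder-empty : ¬ Carrier (Seg α a)
    remainder-empty u = ¬↪Seg (wo α Cα)
      (isLeast (Seg α a) (right-summand _ (Seg α a) (iso-closed B≅ CB) , u))

  emptyGenerator : (∀ D → ¬ NonemptyMember C D) → Generator C (∑ 𝟘 λ ())
  emptyGenerator none = (λ { (() , _) }) , (λ B _ _ → inj₁ (empty↪ ¬0)) , C0 ,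
    λ B → mk⇔ (λ CB → iso (≅-empty ¬0 λ b → none B (CB , b)) base) (⟨⟩⊆ L C0)
    where
    C0 : C (∑ 𝟘 λ ())
    C0 = ord-sums 𝟘 (λ ()) (λ ()) (λ ())
    ¬0 : ¬ Carrier (∑ 𝟘 λ ())
    ¬0 (() , _)

  leastGenerator : {α : LinOrd ℓ} → NonemptyMember C α → IsLeastNonempty C α → Generator C α
  leastGenerator (Cα , a) isLeast = wo _ Cα , least⇒indecomposable Cα isLeast , Cα ,
    λ B → mk⇔ (least⇒generates (Cα , a) isLeast) (⟨⟩⊆ L Cα)

mainTheorem10 : (lem : ∀ {p} → ExcludedMiddle p) →
    ∀ {ℓ c} (C : Class ℓ c) → LeftSumGenerating C →
    (∀ A → C A → IsWellOrder A) →
    Σ (LinOrd ℓ) (λ α → IsWellOrder α × AdditivelyIndecomposable α × C α ×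
      (∀ B → C B ⇔ ⟨ α ⟩ B))
mainTheorem10 lem C L wo = case lem {P = Σ (LinOrd _) (NonemptyMember C)} of λ where
    (no none) → _ , emptyGenerator (λ D m → none (D , m))
    (yes (_ , m)) → let α , mα , isLeast = leastNonempty m in α , leastGenerator mα isLeast
  where open WellOrderClass lem L wo
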